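{- Every clear grand-coalition-first action model is $z$-representable by a clear single-coalition-first neighborhood model.
   Context: $AG$ is a finite nonempty set of agents, $AP$ a countable set of atomic propositions. For a nonempty set $AC$ and $C\subseteq AG$, $JA_C$ is the set of functions $\sigma_C:C\to AC$ ($JA_\emptyset=\{\emptyset\}$); $\sigma_C\subseteq\sigma_{AG}$ means $\sigma_C$ is the restriction of $\sigma_{AG}$ to $C$. A grand-coalition-first action model is $M=(ST,AC,out_{AG},L)$ with $ST,AC$ nonempty, $out_{AG}:ST\times JA_{AG}\to\mathcal P(ST)$, $L:ST\to\mathcal P(AP)$. It determines $out_C(s,\sigma_C)=\bigcup\{out_{AG}(s,\sigma_{AG})\mid\sigma_C\subseteq\sigma_{AG}\}$, $av_C(s)=\{\sigma_C\mid out_C(s,\sigma_C)\neq\emptyset\}$, and actual effectivity functions $AE_C(s)=\{out_C(s,\sigma_C)\mid\sigma_C\in av_C(s)\}$. $M$ is clear if for all $s$ and $\sigma_{AG}\neq\sigma'_{AG}$, $out_{AG}(s,\sigma_{AG})\cap out_{AG}(s,\sigma'_{AG})=\emptyset$. A single-coalition-first neighborhood model is $N=(ST,suc,\{nei_a\}_{a\in AG},L)$ with $suc:ST\to\mathcal P(ST)$ and each $nei_a(s)\subseteq\mathcal P(ST)$ a cover of $suc(s)$ (union $suc(s)$, $\emptyset\notin nei_a(s)$). With $\Delta_1\odot\Delta_2=\{Y_1\cap Y_2\mid Y_i\in\Delta_i,Y_1\cap Y_2\neq\emptyset\}$ (extended to finitely many families, $\bigodot\{\Delta\}=\Delta$):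 $nei_C(s)=\emptyset$ if $suc(s)=\emptyset$; $\{suc(s)\}$ if $suc(s)\neq\emptyset$, $C=\emptyset$; $\bigodot\{nei_a(s)\mid a\in C\}$ otherwise. $N$ is clear if for all $a,s$, $nei_a(s)$ is a partition of $suc(s)$ (cover with pairwise disjoint distinct members). $M$ is $z$-representable by $N$ if they share $ST$ and $L$ and $AE_C=nei_C$ for all $C\subseteq AG$. -}

module Defs where

open import Level using (0ℓ)
open import Data.Nat using (ℕ)
open import Data.Fin using (Fin)
open import Data.Fin.Subset using (Subset; _∈_; Nonempty)
open import Data.Fin.Subset.Properties using (nonempty?)
open import Data.Product using (Σ; Σ-syntax; ∃; ∃-syntax; _×_; _,_; proj₁; proj₂)
open import Relation.Unary using (Pred; _≐_)
open import Relation.Nullary using (yes; no)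
open import Relation.Binary.PropositionalEquality using (_≡_)

-- Sets of states are predicates; families (sets of sets) are indexed
-- families of predicates, compared extensionally.

Fam : Set → Set₁
Fam A = Σ[ I ∈ Set ] (I → Pred A 0ℓ)

_≋_ : {A : Set} → Fam A → Fam A → Set
(I , X) ≋ (J , Y) = (∀ i → ∃[ j ] (X i ≐ Y j)) × (∀ j → ∃[ i ] (X i ≐ Y j))

JA : {n : ℕ} → Set → Subset n → Set
JA {n} AC C = (a : Fin n) → a ∈ C → AC

_⊑_ : {n : ℕ} {AC : Set} {C : Subset n} → JA AC C → (Fin n → AC) → Set
_⊑_ {n} {C = C} σC σ = (a : Fin n) (p : a ∈ C) → σC a p ≡ σ a

record ActionModel (n : ℕ) (AP : Set) : Set₁ where
  field
    ST    : Set
    AC    : Set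
    st₀   : ST          -- ST nonempty
    ac₀   : AC          -- AC nonempty
    outAG : ST → (Fin n → AC) → Pred ST 0ℓ
    L     : ST → Pred AP 0ℓ

  out : (C : Subset n) → ST → JA AC C → Pred ST 0ℓ
  out C s σC x = ∃[ σ ] (σC ⊑ σ × outAG s σ x)

  av : (C : Subset n) → ST → Set
  av C s = Σ[ σC ∈ JA AC C ] ∃ (out C s σC)

  AE : (C : Subset n) → ST → Fam ST
  AE C s = av C s , λ p → out C s (proj₁ p)

-- Clear: distinct grand-coalition actions have disjoint outcomes
-- (stated as: overlapping outcomes force equal actions).
ClearA : {n : ℕ} {AP : Set} → ActionModel n AP → Set
ClearA {n} M = ∀ s (σ σ' : Fin n → AC) x → outAG s σ x → outAG s σ' x → ∀ a → σ a ≡ σ' a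
  where open ActionModel M

record NeighModel (n : ℕ) (ST : Set) (AP : Set) : Set₁ where
  field
    suc : ST → Pred ST 0ℓ
    nei : Fin n → ST → Fam ST
    L   : ST → Pred AP 0ℓ
    cover    : ∀ a s x → (suc s x → ∃[ i ] proj₂ (nei a s) i x)
                       × (∀ i → proj₂ (nei a s) i x → suc s x)
    nonempty : ∀ a s (i : proj₁ (nei a s)) → ∃ (proj₂ (nei a s) i)

  ⨀ : (C : Subset n) → ST → Fam ST
  ⨀ C s = (Σ[ f ∈ ((a : Fin n) → a ∈ C → proj₁ (nei a s)) ]
              ∃ λ x → ∀ a (p : a ∈ C) → proj₂ (nei a s) (f a p) x)
        , λ q x → ∀ a (p : a ∈ C) → proj₂ (nei a s) (proj₁ q a p) x

  neiC : (C : Subset n) → ST → Fam ST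
  neiC C s with nonempty? C
  ... | yes _ = ⨀ C s
  ... | no  _ = ∃ (suc s) , λ _ → suc s

-- Clear: each nei_a(s) is a partition of suc(s) (cover is built in;
-- distinct members are disjoint, stated as: overlapping members are equal).
ClearN : {n : ℕ} {ST AP : Set} → NeighModel n ST AP → Set
ClearN {n} N = ∀ (a : Fin n) s (i j : proj₁ (nei a s)) x →
                 proj₂ (nei a s) i x → proj₂ (nei a s) j x →
                 proj₂ (nei a s) i ≐ proj₂ (nei a s) j
  where open NeighModel N

-- z-representability (ST shared by construction, L shared, AE_C = nei_C).
zRep : {n : ℕ} {AP : Set} (M : ActionModel n AP) →
       NeighModel n (ActionModel.ST M) AP → Set₁
zRep {n} M N = (NeighModel.L N ≡ ActionModel.L M)
             × (∀ (C : Subset n) s → ActionModel.AE M C s ≋ NeighModel.neiC N C s)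

-- Let suc(s) be the set of all outcomes at s and let nei_a(s) consist of the
-- nonempty sets of outcomes at s in which agent a performs a fixed action c.
-- Clearness says every outcome x at s is produced by a unique joint action σₓ,
-- so x lies in the cell of (a , c) iff σₓ(a) = c. Hence each nei_a(s) is a
-- partition, and for nonempty C the intersection of the cells of (a , σ_C(a)),
-- a ∈ C, is exactly out_C(s, σ_C); for C = ∅ both sides are {suc(s)}.
module Submission where

open import Defs
open import Level using (0ℓ)
open import Data.Nat using (ℕ; _<_)
open import Data.Fin using (Fin)
open import Data.Fin.Subset using (Subset; _∈_; Nonempty)
open import Data.Fin.Subset.Properties using (nonempty?)
open import Data.Product using (Σ-syntax; ∃; ∃-syntax; _×_; _,_; proj₁; proj₂)
open import Data.Empty using (⊥-elim)
open import Relation.Nullary using (¬_; yes; no)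
open import Relation.Unary using (Pred; _⊆_; _≐_)
open import Relation.Unary.Properties using (≐-refl)
open import Relation.Binary.PropositionalEquality using (_≡_; refl; sym; trans)
open import Function.Bundles using (_↣_)

module Representation {n : ℕ} {AP : Set} (M : ActionModel n AP) (clear : ClearA M) where
  open ActionModel M

  successors : ST → Pred ST 0ℓ
  successors s x = ∃[ σ ] outAG s σ x

  choiceCell : Fin n → ST → AC → Pred ST 0ℓ
  choiceCell a s c x = ∃[ σ ] (c ≡ σ a × outAG s σ x)

  choiceCells : Fin n → ST → Fam ST
  choiceCells a s = (Σ[ c ∈ AC ] ∃ (choiceCell a s c)) , λ i → choiceCell a s (proj₁ i)

  choiceCell-unique : ∀ {a s c d x} → choiceCell a s c x → choiceCell a s d x → c ≡ d
  choiceCell-unique {a} {s} {x = x} (σ , c≡σa , o) (σ' , d≡σ'a , o') =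
    trans c≡σa (trans (clear s σ σ' x o o' a) (sym d≡σ'a))

  N : NeighModel n ST AP
  N = record
    { suc      = successors
    ; nei      = choiceCells
    ; L        = L
    ; cover    = λ a s x → (λ (σ , o) → (σ a , x , σ , refl , o) , σ , refl , o)
                         , (λ _ (σ , _ , o) → σ , o)
    ; nonempty = λ a s → proj₂
    }

  N-clear : ClearN N
  N-clear a s (c , _) (d , _) x x∈c x∈d with choiceCell-unique x∈c x∈d
  ... | refl = ≐-refl

  ⋂choiceCells : (C : Subset n) → ST → JA AC C → Pred ST 0ℓ
  ⋂choiceCells C s σC x = ∀ a (p : a ∈ C) → choiceCell a s (σC a p) x

  out⊆⋂choiceCells : ∀ C s σC → out C s σC ⊆ ⋂choiceCells C s σC
  out⊆⋂choiceCells C s σC (σ , σC⊑σ , o) a p = σ , σC⊑σ a p , o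

  -- By clearness x has only one producing joint action, so the witnesses of
  -- the individual cells all coincide with that of an arbitrary member a₀ ∈ C.
  ⋂choiceCells⊆out : ∀ {C} → Nonempty C → ∀ s σC → ⋂choiceCells C s σC ⊆ out C s σC
  ⋂choiceCells⊆out (a₀ , p₀) s σC {x} x∈⋂ with x∈⋂ a₀ p₀
  ... | σ₀ , _ , o₀ = σ₀ , σC⊑σ₀ , o₀
    where
    σC⊑σ₀ : σC ⊑ σ₀
    σC⊑σ₀ a p with x∈⋂ a p
    ... | σ , σCa≡σa , o = trans σCa≡σa (clear s σ σ₀ x o o₀ a)

  out≐⋂choiceCells : ∀ {C} → Nonempty C → ∀ s σC → out C s σC ≐ ⋂choiceCells C s σC
  out≐⋂choiceCells {C} C≢∅ s σC = out⊆⋂choiceCells C s σC , ⋂choiceCells⊆out C≢∅ s σC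

  out⊆successors : ∀ C s σC → out C s σC ⊆ successors s
  out⊆successors C s σC (σ , _ , o) = σ , o

  successors⊆out : ∀ {C} → ¬ Nonempty C → ∀ s σC → successors s ⊆ out C s σC
  successors⊆out C≡∅ s σC (σ , o) = σ , (λ a p → ⊥-elim (C≡∅ (a , p))) , o

  out≐successors : ∀ {C} → ¬ Nonempty C → ∀ s σC → out C s σC ≐ successors s
  out≐successors {C} C≡∅ s σC = out⊆successors C s σC , successors⊆out C≡∅ s σC

  AE≋⨀ : ∀ {C} → Nonempty C → ∀ s → AE C s ≋ NeighModel.⨀ N C s
  AE≋⨀ {C} C≢∅ s =
      (λ (σC , x , x∈out) → let x∈⋂ = out⊆⋂choiceCells C s σC x∈out in
         ((λ a p → σC a p , x , x∈⋂ a p) , x , x∈⋂) , out≐⋂choiceCells C≢∅ s σC)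
    , (λ (f , x , x∈⋂) → let σC = λ a p → proj₁ (f a p) in
         (σC , x , ⋂choiceCells⊆out C≢∅ s σC x∈⋂) , out≐⋂choiceCells C≢∅ s σC)

  AE≋successors : ∀ {C} → ¬ Nonempty C → ∀ s → AE C s ≋ (∃ (successors s) , λ _ → successors s)
  AE≋successors {C} C≡∅ s =
      (λ (σC , x , x∈out) → (x , out⊆successors C s σC x∈out) , out≐successors C≡∅ s σC)
    , (λ (x , x∈suc) → let σC = λ a p → ⊥-elim (C≡∅ (a , p)) in
         (σC , x , successors⊆out C≡∅ s σC x∈suc) , out≐successors C≡∅ s σC)

  AE≋neiC : ∀ C s → AE C s ≋ NeighModel.neiC N C s
  AE≋neiC C s with nonempty? C
  ... | yes C≢∅ = AE≋⨀ C≢∅ s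
  ... | no  C≡∅ = AE≋successors C≡∅ s

theorem5p7 : (n : ℕ) → 0 < n → (AP : Set) → AP ↣ ℕ →
    (M : ActionModel n AP) → ClearA M →
    Σ[ N ∈ NeighModel n (ActionModel.ST M) AP ] (ClearN N × zRep M N)
theorem5p7 n _ AP _ M clear = N , N-clear , refl , AE≋neiC
  where open Representation M clear
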